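{- Let $R$ be a commutative ring and $N\subset M$ $R$-modules with $N$ finitely generated and $M$ finitely presented. For each positive integer $r$, the ideal $\mathrm{Fitt}_R(M/N)$ annihilates the cokernel of the canonical map $\bigwedge^r_RN\to\bigwedge^r_RM$.
   Context: $\mathrm{Fitt}_R$ denotes the $0$th Fitting ideal. -}

module Defs where

open import Level using (Level; _⊔_)
open import Algebra.Bundles using (CommutativeRing)
open import Algebra.Module.Bundles using (Module)
open import Data.Nat using (ℕ; zero; suc)
open import Data.Fin using (Fin; zero; suc; punchIn)
open import Data.Product using (Σ; ∃; _×_; _,_; proj₁; proj₂)
open import Data.List using (List; []; _∷_; _++_; map)
open import Data.Vec.Functional using (updateAt)
open import Function using (_∘_; const)
open import Function.Definitions using (Injective)
open import Relation.Binary.PropositionalEquality using (_≡_; _≢_)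
open import Relation.Unary using (Pred)
import Data.List.Membership.Propositional

module _ {c ℓ : Level} (R : CommutativeRing c ℓ) where
  open CommutativeRing R using (Carrier; _+_; _*_; _-_; 0#; 1#)

  sumR : ∀ {n} → (Fin n → Carrier) → Carrier
  sumR {zero}  f = 0#
  sumR {suc n} f = f zero + sumR (f ∘ suc)

  altSumR : ∀ {n} → (Fin n → Carrier) → Carrier
  altSumR {zero}  f = 0#
  altSumR {suc n} f = f zero - altSumR (f ∘ suc)

  det : ∀ {n} → (Fin n → Fin n → Carrier) → Carrier
  det {zero}  A = 1#
  det {suc n} A =
    altSumR (λ j → A zero j * det (λ i k → A (suc i) (punchIn j k)))

module _ {c ℓ m ℓm : Level} (R : CommutativeRing c ℓ) (M : Module R m ℓm) where
  open CommutativeRing R using (Carrier; _+_; _*_; 0#; _≈_)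
  open Module M using (Carrierᴹ; _≈ᴹ_; _+ᴹ_; _*ₗ_; 0ᴹ; -ᴹ_)

  lincomb : ∀ {n} → (Fin n → Carrier) → (Fin n → Carrierᴹ) → Carrierᴹ
  lincomb {zero}  a x = 0ᴹ
  lincomb {suc n} a x = (a zero *ₗ x zero) +ᴹ lincomb (a ∘ suc) (x ∘ suc)

  record IsSubmodule {ℓn : Level} (N : Pred Carrierᴹ ℓn)
      : Set (c ⊔ m ⊔ ℓm ⊔ ℓn) where
    field
      resp  : ∀ {x y} → x ≈ᴹ y → N x → N y
      zero∈ : N 0ᴹ
      +∈    : ∀ {x y} → N x → N y → N (x +ᴹ y)
      *ₗ∈   : ∀ s {x} → N x → N (s *ₗ x)

  FinitelyGenerated : {ℓn : Level} → Pred Carrierᴹ ℓn → Set (c ⊔ m ⊔ ℓm ⊔ ℓn)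
  FinitelyGenerated N =
    Σ ℕ λ n → Σ (Fin n → Carrierᴹ) λ g →
      (∀ i → N (g i)) ×
      (∀ x → N x → Σ (Fin n → Carrier) λ a → x ≈ᴹ lincomb a g)

  -- the relations  rel : Fin k → (Fin n → R)  generate the kernel of
  -- the map R^n → M, a ↦ Σ a_i g_i, composed with a "vanishing" predicate Z
  -- (Z = (_≈ 0) for M itself, Z = N for the quotient M/N)
  GeneratesKernel : {ℓz : Level} (Z : Pred Carrierᴹ ℓz) →
    ∀ {n k} → (Fin n → Carrierᴹ) → (Fin k → Fin n → Carrier) →
    Set (c ⊔ ℓ ⊔ ℓz)
  GeneratesKernel Z {n} {k} g rel =
    (∀ j → Z (lincomb (rel j) g)) ×
    (∀ a → Z (lincomb a g) →
       Σ (Fin k → Carrier) λ d → ∀ i → a i ≈ sumR R (λ j → d j * rel j i))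

  FinitelyPresented : Set (c ⊔ ℓ ⊔ m ⊔ ℓm)
  FinitelyPresented =
    Σ ℕ λ n → Σ (Fin n → Carrierᴹ) λ g →
      (∀ x → Σ (Fin n → Carrier) λ a → x ≈ᴹ lincomb a g) ×
      (Σ ℕ λ k → Σ (Fin k → Fin n → Carrier) λ rel →
         GeneratesKernel (λ x → x ≈ᴹ 0ᴹ) g rel)

  -- A finite presentation  R^k --rel--> R^n --g--> M/N --> 0  of M/N:
  -- g generates M modulo N, and the rows of rel generate all relations
  -- among the images of g in M/N.
  QuotPresentation : {ℓn : Level} → Pred Carrierᴹ ℓn →
    ∀ {n k} → (Fin n → Carrierᴹ) → (Fin k → Fin n → Carrier) →
    Set (c ⊔ ℓ ⊔ m ⊔ ℓn)
  QuotPresentation N {n} g rel =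
    (∀ x → Σ (Fin n → Carrier) λ a → N (x +ᴹ (-ᴹ lincomb a g))) ×
    GeneratesKernel N g rel

  -- a ∈ Fitt_R(M/N): the ideal generated by the n×n minors of a relation
  -- matrix of a finite presentation of M/N with n generators.
  InFitt : {ℓn : Level} → Pred Carrierᴹ ℓn → Pred Carrier (c ⊔ ℓ ⊔ m ⊔ ℓn)
  InFitt N x =
    Σ ℕ λ n → Σ ℕ λ k → Σ (Fin n → Carrierᴹ) λ g →
    Σ (Fin k → Fin n → Carrier) λ rel →
      QuotPresentation N g rel ×
      (Σ ℕ λ t → Σ (Fin t → Carrier) λ coef →
       Σ (Fin t → Fin n → Fin k) λ sel →
         (∀ u → Injective _≡_ _≡_ (sel u)) ×
         (x ≈ sumR R (λ u → coef u * det R (λ i j → rel (sel u i) j))))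

  -- The r-th exterior power ∧^r M, as the free R-module on r-tuples of
  -- elements of M (formal finite sums Σ c·(m₁,…,m_r)) modulo the
  -- equivalence generated by multilinearity and the alternating relation.

  Wedge : ℕ → Set (c ⊔ m)
  Wedge r = List (Carrier × (Fin r → Carrierᴹ))

  scaleW : ∀ {r} → Carrier → Wedge r → Wedge r
  scaleW s = map (λ p → (s * proj₁ p , proj₂ p))

  set : ∀ {r} → (Fin r → Carrierᴹ) → Fin r → Carrierᴹ → Fin r → Carrierᴹ
  set v i y = updateAt v i (const y)

  infix 4 _∼W_
  data _∼W_ {r : ℕ} : Wedge r → Wedge r → Set (c ⊔ ℓ ⊔ m ⊔ ℓm) where
    ∼refl  : ∀ {ω} → ω ∼W ω
    ∼sym   : ∀ {ω η} → ω ∼W η → η ∼W ω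
    ∼trans : ∀ {ω η θ} → ω ∼W η → η ∼W θ → ω ∼W θ
    ∼++    : ∀ {ω ω' η η'} → ω ∼W ω' → η ∼W η' → ω ++ η ∼W ω' ++ η'
    ∼comm  : ∀ ω η → ω ++ η ∼W η ++ ω
    ∼cong  : ∀ {a b v w} → a ≈ b → (∀ i → v i ≈ᴹ w i) →
             (a , v) ∷ [] ∼W (b , w) ∷ []
    ∼zero  : ∀ {a v} → a ≈ 0# → (a , v) ∷ [] ∼W []
    ∼add   : ∀ a b v → (a , v) ∷ (b , v) ∷ [] ∼W (a + b , v) ∷ []
    ∼lin+  : ∀ a v i y z →
             (a , set v i (y +ᴹ z)) ∷ [] ∼W (a , set v i y) ∷ (a , set v i z) ∷ []
    ∼lin*  : ∀ a v i s y →
             (a , set v i (s *ₗ y)) ∷ [] ∼W (a * s , set v i y) ∷ []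
    ∼alt   : ∀ a v {i j} → i ≢ j → v i ≈ᴹ v j → (a , v) ∷ [] ∼W []

  InImageWedgeN : {ℓn : Level} → Pred Carrierᴹ ℓn → ∀ {r} → Wedge r →
    Set (c ⊔ ℓ ⊔ m ⊔ ℓm ⊔ ℓn)
  InImageWedgeN N {r} ω =
    Σ (Wedge r) λ η → (∀ {p} → p Data.List.Membership.Propositional.∈ η → ∀ i → N (proj₂ p i)) × (ω ∼W η)

-- Write a as a combination of maximal minors det B of a relation matrix for generators
-- g₁,…,g_n of M modulo N, and let v₁,…,v_r ∈ M with v_p ≡ Σ_j a_pj g_j modulo N. The rows
-- of the block matrix C = (B 0; -a 1) are relations modulo N among g₁,…,g_n,v₁,…,v_r, and
-- det C = det B. So it suffices that, whenever every row of C applied to x₁,…,x_n lies in N,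
-- det C · x_{s+1} ∧ … ∧ x_n lies in the image of ⋀ N, for every s. For s = 0 this is the
-- identity (Cx)₁ ∧ … ∧ (Cx)_n = det C · x₁ ∧ … ∧ x_n. For s > 0 pass to M ⊕ R, giving x_s the
-- extra coordinate 1 and every other x_k the coordinate 0: the case s − 1 there puts
-- det C · x_s ∧ … ∧ x_n in the image of ⋀ (N ⊕ R), and contracting with the projection onto
-- the new coordinate removes the marked factor x_s and preserves that image.

module Submission where

open import Defs
open import Level using (Level; _⊔_)
open import Algebra.Bundles using (CommutativeRing)
open import Algebra.Module.Bundles using (Module)
import Algebra.Module.Construct.DirectProduct as DirectProduct
import Algebra.Module.Construct.TensorUnit as TensorUnit
open import Data.Empty using (⊥-elim)
open import Data.Fin using (Fin; zero; suc; punchIn; _↑ˡ_; _↑ʳ_; splitAt; cast; toℕ)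
import Data.Fin.Properties as FinP
open import Data.List using (List; []; _∷_; _++_; map; concatMap)
open import Data.List.Properties using (map-++; concatMap-++; ++-assoc; ++-identityʳ)
open import Data.List.Relation.Unary.All as All using (All; []; _∷_; lookup)
open import Data.List.Relation.Unary.All.Properties using (++⁺; map⁺; concat⁺)
open import Data.Nat using (ℕ; zero; suc; _≤_) renaming (_+_ to _+ℕ_)
open import Data.Nat.Properties using (+-suc)
open import Data.Product using (Σ; _×_; _,_; proj₁; proj₂; uncurry)
open import Data.Sum using (_⊎_; inj₁; inj₂; [_,_]′)
open import Data.Vec.Functional using () renaming (_∷_ to _∷ᵥ_; _++_ to _++ᵥ_)
open import Function using (_∘_)
open import Relation.Binary.PropositionalEquality as P using (_≡_; _≢_)
open import Relation.Unary using (Pred)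
import Relation.Binary.Reasoning.Setoid as SetoidReasoning

data Split (n r : ℕ) : Fin (n +ℕ r) → Set where
  left  : (i : Fin n) → Split n r (i ↑ˡ r)
  right : (p : Fin r) → Split n r (n ↑ʳ p)

split : ∀ n r (i : Fin (n +ℕ r)) → Split n r i
split zero    r i       = right i
split (suc n) r zero    = left zero
split (suc n) r (suc i) with split n r i
... | left j  = left (suc j)
... | right p = right p

punchIn-↑ˡ-↑ˡ : ∀ {n} r (j : Fin (suc n)) (k : Fin n) → punchIn (j ↑ˡ r) (k ↑ˡ r) ≡ punchIn j k ↑ˡ r
punchIn-↑ˡ-↑ˡ r zero    k       = P.refl
punchIn-↑ˡ-↑ˡ r (suc j) zero    = P.refl
punchIn-↑ˡ-↑ˡ r (suc j) (suc k) = P.cong suc (punchIn-↑ˡ-↑ˡ r j k)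

punchIn-↑ˡ-↑ʳ : ∀ {n} r (j : Fin (suc n)) (q : Fin r) → punchIn (j ↑ˡ r) (n ↑ʳ q) ≡ suc n ↑ʳ q
punchIn-↑ˡ-↑ʳ         r zero    q = P.refl
punchIn-↑ˡ-↑ʳ {suc n} r (suc j) q = P.cong suc (punchIn-↑ˡ-↑ʳ r j q)

cast-injective : ∀ {m n} (m≡n : m ≡ n) {i j : Fin m} → cast m≡n i ≡ cast m≡n j → i ≡ j
cast-injective m≡n {i} {j} eq = FinP.toℕ-injective (begin
  toℕ i            ≡⟨ FinP.toℕ-cast m≡n i ⟨
  toℕ (cast m≡n i) ≡⟨ P.cong toℕ eq ⟩
  toℕ (cast m≡n j) ≡⟨ FinP.toℕ-cast m≡n j ⟩
  toℕ j            ∎)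
  where open P.≡-Reasoning

module _ {c ℓ : Level} (R : CommutativeRing c ℓ) where
  open CommutativeRing R hiding (zero) renaming (Carrier to A)
  open import Algebra.Properties.Ring ring
    using (-‿distribˡ-*; -‿distribʳ-*; -‿involutive; -‿+-comm; -0#≈0#; -1*x≈-x)
  open import Algebra.Properties.CommutativeSemigroup *-commutativeSemigroup using (xy∙z≈xz∙y)

  sumR-cong : ∀ {n} {f g : Fin n → A} → (∀ i → f i ≈ g i) → sumR R f ≈ sumR R g
  sumR-cong {zero}  f≈g = refl
  sumR-cong {suc n} f≈g = +-cong (f≈g zero) (sumR-cong (f≈g ∘ suc))

  altSumR-cong : ∀ {n} {f g : Fin n → A} → (∀ i → f i ≈ g i) → altSumR R f ≈ altSumR R g
  altSumR-cong {zero}  f≈g = refl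
  altSumR-cong {suc n} f≈g = +-cong (f≈g zero) (-‿cong (altSumR-cong (f≈g ∘ suc)))

  altSumR-zero : ∀ {n} (f : Fin n → A) → (∀ i → f i ≈ 0#) → altSumR R f ≈ 0#
  altSumR-zero {zero}  f f≈0 = refl
  altSumR-zero {suc n} f f≈0 =
    trans (+-cong (f≈0 zero) (trans (-‿cong (altSumR-zero (f ∘ suc) (f≈0 ∘ suc))) -0#≈0#)) (+-identityˡ 0#)

  sign : ∀ {n} → Fin n → A
  sign zero    = 1#
  sign (suc j) = - sign j

  sumR-sign : ∀ {n} a (f : Fin n → A) → sumR R (λ j → a * f j * sign j) ≈ a * altSumR R f
  sumR-sign {zero}  a f = sym (zeroʳ a)
  sumR-sign {suc n} a f = begin
      a * f zero * 1# + sumR R (λ j → a * f (suc j) * (- sign j))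
    ≈⟨ +-cong (*-identityʳ _) (sumR-cong (λ j → move-minus (f (suc j)) (sign j))) ⟩
      a * f zero + sumR R (λ j → (- a) * f (suc j) * sign j)
    ≈⟨ +-congˡ (sumR-sign (- a) (f ∘ suc)) ⟩
      a * f zero + (- a) * altSumR R (f ∘ suc)
    ≈⟨ +-congˡ (trans (sym (-‿distribˡ-* a _)) (-‿distribʳ-* a _)) ⟩
      a * f zero + a * (- altSumR R (f ∘ suc))
    ≈⟨ distribˡ a _ _ ⟨
      a * (f zero - altSumR R (f ∘ suc)) ∎
    where
      open SetoidReasoning setoid
      move-minus : ∀ x s → a * x * (- s) ≈ (- a) * x * s
      move-minus x s = trans (sym (-‿distribʳ-* (a * x) s))
                        (trans (-‿distribˡ-* (a * x) s) (*-congʳ (-‿distribˡ-* a x)))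

  det-cong : ∀ {n} {B C : Fin n → Fin n → A} → (∀ i j → B i j ≈ C i j) → det R B ≈ det R C
  det-cong {zero}  B≈C = refl
  det-cong {suc n} B≈C =
    altSumR-cong (λ j → *-cong (B≈C zero j) (det-cong (λ i k → B≈C (suc i) (punchIn j k))))

  δ : ∀ {r} → Fin r → Fin r → A
  δ zero    zero    = 1#
  δ zero    (suc _) = 0#
  δ (suc _) zero    = 0#
  δ (suc i) (suc j) = δ i j

  δ-diag : ∀ {r} (i : Fin r) → δ i i ≈ 1#
  δ-diag zero    = refl
  δ-diag (suc i) = δ-diag i

  δ-off : ∀ {r} {i j : Fin r} → i ≢ j → δ i j ≈ 0#
  δ-off {i = zero}  {zero}  i≢j = ⊥-elim (i≢j P.refl)
  δ-off {i = zero}  {suc j} _   = refl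
  δ-off {i = suc i} {zero}  _   = refl
  δ-off {i = suc i} {suc j} i≢j = δ-off (i≢j ∘ P.cong suc)

  det-δ : ∀ r → det R (δ {r}) ≈ 1#
  det-δ zero    = refl
  det-δ (suc r) =
    trans (+-cong (trans (*-identityˡ _) (det-δ r))
                  (trans (-‿cong (altSumR-zero offDiagonal (λ _ → zeroˡ _))) -0#≈0#))
          (+-identityʳ 1#)
    where
      offDiagonal : Fin r → A
      offDiagonal j = δ {suc r} zero (suc j) * det R (λ i k → δ (suc i) (punchIn (suc j) k))

  blockMatrix : ∀ {n r} → (Fin n → Fin n → A) → (Fin r → Fin n → A) →
                Fin (n +ℕ r) → Fin (n +ℕ r) → A
  blockMatrix {n} {r} B a i j = entry (splitAt n i) (splitAt n j)
    where
      entry : Fin n ⊎ Fin r → Fin n ⊎ Fin r → A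
      entry (inj₁ i) (inj₁ j) = B i j
      entry (inj₁ i) (inj₂ q) = 0#
      entry (inj₂ p) (inj₁ j) = - a p j
      entry (inj₂ p) (inj₂ q) = δ p q

  module _ {n r : ℕ} (B : Fin n → Fin n → A) (a : Fin r → Fin n → A) where
    blockMatrix-ll : ∀ i j → blockMatrix B a (i ↑ˡ r) (j ↑ˡ r) ≡ B i j
    blockMatrix-ll i j rewrite FinP.splitAt-↑ˡ n i r | FinP.splitAt-↑ˡ n j r = P.refl

    blockMatrix-lr : ∀ i q → blockMatrix B a (i ↑ˡ r) (n ↑ʳ q) ≡ 0#
    blockMatrix-lr i q rewrite FinP.splitAt-↑ˡ n i r | FinP.splitAt-↑ʳ n r q = P.refl

    blockMatrix-rl : ∀ p j → blockMatrix B a (n ↑ʳ p) (j ↑ˡ r) ≡ - a p j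
    blockMatrix-rl p j rewrite FinP.splitAt-↑ʳ n r p | FinP.splitAt-↑ˡ n j r = P.refl

    blockMatrix-rr : ∀ p q → blockMatrix B a (n ↑ʳ p) (n ↑ʳ q) ≡ δ p q
    blockMatrix-rr p q rewrite FinP.splitAt-↑ʳ n r p | FinP.splitAt-↑ʳ n r q = P.refl

  altSumR-↑ˡ : ∀ n {r} (f : Fin (n +ℕ r) → A) → (∀ q → f (n ↑ʳ q) ≈ 0#) →
               altSumR R f ≈ altSumR R (f ∘ (_↑ˡ r))
  altSumR-↑ˡ zero    f f≈0 = altSumR-zero f f≈0
  altSumR-↑ˡ (suc n) f f≈0 = +-congˡ (-‿cong (altSumR-↑ˡ n (f ∘ suc) f≈0))

  -- Expand along the first row: its right block vanishes and every complementary minor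
  -- again has the block shape.
  det-blockMatrix : ∀ n r (B : Fin n → Fin n → A) (a : Fin r → Fin n → A) →
                    det R (blockMatrix B a) ≈ det R B
  det-blockMatrix zero    r B a = det-δ r
  det-blockMatrix (suc n) r B a =
    trans (altSumR-↑ˡ (suc n) expansion
             (λ q → trans (*-congʳ (reflexive (blockMatrix-lr B a zero q))) (zeroˡ _)))
          (altSumR-cong (λ j → *-cong (reflexive (blockMatrix-ll B a zero j))
                                      (trans (det-cong (minor j)) (det-blockMatrix n r (B' j) (a' j)))))
    where
      expansion : Fin (suc n +ℕ r) → A
      expansion j = blockMatrix B a zero j * det R (λ i k → blockMatrix B a (suc i) (punchIn j k))
      B' : Fin (suc n) → Fin n → Fin n → A
      B' j i k = B (suc i) (punchIn j k)
      a' : Fin (suc n) → Fin r → Fin n → A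
      a' j p k = a p (punchIn j k)
      via : ∀ i {k k' x y} → k ≡ k' → blockMatrix B a i k' ≡ x → y ≡ x → blockMatrix B a i k ≈ y
      via i P.refl p q = reflexive (P.trans p (P.sym q))
      minor : ∀ j i k → blockMatrix B a (suc i) (punchIn (j ↑ˡ r) k) ≈ blockMatrix (B' j) (a' j) i k
      minor j i k with split n r i | split n r k
      ... | left i' | left k' = via (suc i' ↑ˡ r) (punchIn-↑ˡ-↑ˡ r j k')
                                  (blockMatrix-ll B a (suc i') (punchIn j k')) (blockMatrix-ll (B' j) (a' j) i' k')
      ... | left i' | right q = via (suc i' ↑ˡ r) (punchIn-↑ˡ-↑ʳ r j q)
                                  (blockMatrix-lr B a (suc i') q) (blockMatrix-lr (B' j) (a' j) i' q)
      ... | right p | left k' = via (suc n ↑ʳ p) (punchIn-↑ˡ-↑ˡ r j k')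
                                  (blockMatrix-rl B a p (punchIn j k')) (blockMatrix-rl (B' j) (a' j) p k')
      ... | right p | right q = via (suc n ↑ʳ p) (punchIn-↑ˡ-↑ʳ r j q)
                                  (blockMatrix-rr B a p q) (blockMatrix-rr (B' j) (a' j) p q)

  module LinearCombinations {m ℓm : Level} (M : Module R m ℓm) where
    open Module M
    open import Algebra.Properties.AbelianGroup +ᴹ-abelianGroup using (⁻¹-∙-comm; inverseʳ-unique)
    open SetoidReasoning ≈ᴹ-setoid

    lincomb-cong : ∀ {n} {b b' : Fin n → A} {x x' : Fin n → Carrierᴹ} →
                   (∀ i → b i ≈ b' i) → (∀ i → x i ≈ᴹ x' i) → lincomb R M b x ≈ᴹ lincomb R M b' x'
    lincomb-cong {zero}  b≈b' x≈x' = ≈ᴹ-refl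
    lincomb-cong {suc n} b≈b' x≈x' =
      +ᴹ-cong (*ₗ-cong (b≈b' zero) (x≈x' zero)) (lincomb-cong (b≈b' ∘ suc) (x≈x' ∘ suc))

    lincomb-congˡ : ∀ {n} {b b' : Fin n → A} {x : Fin n → Carrierᴹ} →
                    (∀ i → b i ≈ b' i) → lincomb R M b x ≈ᴹ lincomb R M b' x
    lincomb-congˡ b≈b' = lincomb-cong b≈b' (λ _ → ≈ᴹ-refl)

    lincomb-zero : ∀ {n} {b : Fin n → A} (x : Fin n → Carrierᴹ) → (∀ i → b i ≈ 0#) →
                   lincomb R M b x ≈ᴹ 0ᴹ
    lincomb-zero {zero}  x b≈0 = ≈ᴹ-refl
    lincomb-zero {suc n} x b≈0 =
      ≈ᴹ-trans (+ᴹ-cong (≈ᴹ-trans (*ₗ-cong (b≈0 zero) ≈ᴹ-refl) (*ₗ-zeroˡ _))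
                        (lincomb-zero (x ∘ suc) (b≈0 ∘ suc)))
               (+ᴹ-identityˡ 0ᴹ)

    -‿*ₗ : ∀ s y → (- s) *ₗ y ≈ᴹ -ᴹ (s *ₗ y)
    -‿*ₗ s y = inverseʳ-unique (s *ₗ y) ((- s) *ₗ y) (begin
      s *ₗ y +ᴹ (- s) *ₗ y  ≈⟨ *ₗ-distribʳ y s (- s) ⟨
      (s - s) *ₗ y          ≈⟨ *ₗ-cong (-‿inverseʳ s) ≈ᴹ-refl ⟩
      0# *ₗ y               ≈⟨ *ₗ-zeroˡ y ⟩
      0ᴹ                    ∎)

    lincomb-neg : ∀ {n} (b : Fin n → A) (x : Fin n → Carrierᴹ) →
                  lincomb R M (λ k → - b k) x ≈ᴹ -ᴹ lincomb R M b x
    lincomb-neg {zero}  b x = inverseʳ-unique 0ᴹ 0ᴹ (+ᴹ-identityˡ 0ᴹ)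
    lincomb-neg {suc n} b x =
      ≈ᴹ-trans (+ᴹ-cong (-‿*ₗ (b zero) (x zero)) (lincomb-neg (b ∘ suc) (x ∘ suc))) (⁻¹-∙-comm _ _)

    lincomb-δ : ∀ {r} (v : Fin r → Carrierᴹ) p → lincomb R M (δ p) v ≈ᴹ v p
    lincomb-δ {suc r} v zero    =
      ≈ᴹ-trans (+ᴹ-cong (*ₗ-identityˡ _) (lincomb-zero (v ∘ suc) (λ _ → refl))) (+ᴹ-identityʳ _)
    lincomb-δ {suc r} v (suc p) = ≈ᴹ-trans (+ᴹ-cong (*ₗ-zeroˡ _) (lincomb-δ (v ∘ suc) p)) (+ᴹ-identityˡ _)

    lincomb-++ᵥ : ∀ n {r} (b : Fin (n +ℕ r) → A) (x : Fin n → Carrierᴹ) (y : Fin r → Carrierᴹ) →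
                  lincomb R M b (x ++ᵥ y) ≈ᴹ lincomb R M (b ∘ (_↑ˡ r)) x +ᴹ lincomb R M (b ∘ (n ↑ʳ_)) y
    lincomb-++ᵥ zero    b x y = ≈ᴹ-sym (+ᴹ-identityˡ _)
    lincomb-++ᵥ (suc n) b x y =
      ≈ᴹ-trans (+ᴹ-congˡ (≈ᴹ-trans (lincomb-cong (λ _ → refl) (λ i → ≈ᴹ-reflexive (++ᵥ-suc i)))
                                   (lincomb-++ᵥ n (b ∘ suc) (x ∘ suc) y)))
               (≈ᴹ-sym (+ᴹ-assoc _ _ _))
      where
        ++ᵥ-suc : ∀ i → (x ++ᵥ y) (suc i) ≡ ((x ∘ suc) ++ᵥ y) i
        ++ᵥ-suc i with splitAt n i
        ... | inj₁ _ = P.refl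
        ... | inj₂ _ = P.refl

    lincomb-extract : ∀ {n} (b : Fin (suc n) → A) (x : Fin (suc n) → Carrierᴹ) j →
                      lincomb R M b x ≈ᴹ (b j *ₗ x j) +ᴹ lincomb R M (b ∘ punchIn j) (x ∘ punchIn j)
    lincomb-extract         b x zero    = ≈ᴹ-refl
    lincomb-extract {suc n} b x (suc j) =
      ≈ᴹ-trans (+ᴹ-congˡ (lincomb-extract (b ∘ suc) (x ∘ suc) j))
        (≈ᴹ-trans (≈ᴹ-sym (+ᴹ-assoc _ _ _)) (≈ᴹ-trans (+ᴹ-congʳ (+ᴹ-comm _ _)) (+ᴹ-assoc _ _ _)))

    module _ {n r : ℕ} (B : Fin n → Fin n → A) (a : Fin r → Fin n → A)
             (x : Fin n → Carrierᴹ) (y : Fin r → Carrierᴹ) where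
      lincomb-blockMatrix-↑ˡ : ∀ i →
        lincomb R M (blockMatrix B a (i ↑ˡ r)) (x ++ᵥ y) ≈ᴹ lincomb R M (B i) x
      lincomb-blockMatrix-↑ˡ i = begin
        lincomb R M (blockMatrix B a (i ↑ˡ r)) (x ++ᵥ y)
          ≈⟨ lincomb-++ᵥ n _ x y ⟩
        lincomb R M (λ k → blockMatrix B a (i ↑ˡ r) (k ↑ˡ r)) x
          +ᴹ lincomb R M (λ q → blockMatrix B a (i ↑ˡ r) (n ↑ʳ q)) y
          ≈⟨ +ᴹ-cong (lincomb-congˡ (reflexive ∘ blockMatrix-ll B a i))
                     (lincomb-zero y (reflexive ∘ blockMatrix-lr B a i)) ⟩
        lincomb R M (B i) x +ᴹ 0ᴹ
          ≈⟨ +ᴹ-identityʳ _ ⟩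
        lincomb R M (B i) x ∎

      lincomb-blockMatrix-↑ʳ : ∀ p →
        lincomb R M (blockMatrix B a (n ↑ʳ p)) (x ++ᵥ y) ≈ᴹ y p +ᴹ -ᴹ lincomb R M (a p) x
      lincomb-blockMatrix-↑ʳ p = begin
        lincomb R M (blockMatrix B a (n ↑ʳ p)) (x ++ᵥ y)
          ≈⟨ lincomb-++ᵥ n _ x y ⟩
        lincomb R M (λ k → blockMatrix B a (n ↑ʳ p) (k ↑ˡ r)) x
          +ᴹ lincomb R M (λ q → blockMatrix B a (n ↑ʳ p) (n ↑ʳ q)) y
          ≈⟨ +ᴹ-cong (≈ᴹ-trans (lincomb-congˡ (reflexive ∘ blockMatrix-rl B a p)) (lincomb-neg (a p) x))
                     (≈ᴹ-trans (lincomb-congˡ (reflexive ∘ blockMatrix-rr B a p)) (lincomb-δ y p)) ⟩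
        -ᴹ lincomb R M (a p) x +ᴹ y p
          ≈⟨ +ᴹ-comm _ _ ⟩
        y p +ᴹ -ᴹ lincomb R M (a p) x ∎

  module Wedges {m ℓm : Level} (M : Module R m ℓm) where
    open Module M
    open LinearCombinations M using (lincomb-extract)

    W : ℕ → Set (c ⊔ m)
    W = Wedge R M

    Term : ℕ → Set (c ⊔ m)
    Term r = A × (Fin r → Carrierᴹ)

    infix 4 _∼_
    _∼_ : ∀ {r} → W r → W r → Set (c ⊔ ℓ ⊔ m ⊔ ℓm)
    _∼_ = _∼W_ R M

    ≡⇒∼ : ∀ {r} {ω η : W r} → ω ≡ η → ω ∼ η
    ≡⇒∼ P.refl = ∼refl

    ∼-entries : ∀ {r a} {v w : Fin r → Carrierᴹ} → (∀ i → v i ≈ᴹ w i) →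
                (a , v) ∷ [] ∼ (a , w) ∷ []
    ∼-entries = ∼cong refl

    ∼-coefficient : ∀ {r a b} {v : Fin r → Carrierᴹ} → a ≈ b → (a , v) ∷ [] ∼ (b , v) ∷ []
    ∼-coefficient a≈b = ∼cong a≈b (λ _ → ≈ᴹ-refl)

    ∷ᵥ-cong : ∀ {r u u'} {v v' : Fin r → Carrierᴹ} → u ≈ᴹ u' → (∀ k → v k ≈ᴹ v' k) →
              ∀ k → (u ∷ᵥ v) k ≈ᴹ (u' ∷ᵥ v') k
    ∷ᵥ-cong u≈u' v≈v' zero    = u≈u'
    ∷ᵥ-cong u≈u' v≈v' (suc k) = v≈v' k

    ∷ᵥ-head-tail : ∀ {n} (x : Fin (suc n) → Carrierᴹ) k → (x zero ∷ᵥ (x ∘ suc)) k ≈ᴹ x k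
    ∷ᵥ-head-tail x zero    = ≈ᴹ-refl
    ∷ᵥ-head-tail x (suc k) = ≈ᴹ-refl

    infixr 5 _∷∼_
    _∷∼_ : ∀ {r} {x y : Term r} {ω η} → x ∷ [] ∼ y ∷ [] → ω ∼ η → x ∷ ω ∼ y ∷ η
    x∼y ∷∼ ω∼η = ∼++ x∼y ω∼η

    drop-null : ∀ {r} {x : Term r} {ω} → x ∷ [] ∼ [] → x ∷ ω ∼ ω
    drop-null x∼0 = ∼++ x∼0 ∼refl

    cancel : ∀ {r} a (v : Fin r → Carrierᴹ) → (a , v) ∷ (- a , v) ∷ [] ∼ []
    cancel a v = ∼trans (∼add a (- a) v) (∼zero (-‿inverseʳ a))

    interchange : ∀ {r} (x y : Term r) (α β : W r) → (x ∷ α) ++ (y ∷ β) ∼ x ∷ y ∷ (α ++ β)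
    interchange x y α β =
      ∼refl {ω = x ∷ []} ∷∼ ∼trans (∼comm α (y ∷ β)) (∼refl {ω = y ∷ []} ∷∼ ∼comm β α)

    module Additive {a} {X : Set a} {r} (F : List X → W r)
                    (F-++ : ∀ xs ys → F (xs ++ ys) ≡ F xs ++ F ys) where
      resp-++ : ∀ {xs xs' ys ys'} → F xs ∼ F xs' → F ys ∼ F ys' → F (xs ++ ys) ∼ F (xs' ++ ys')
      resp-++ {xs} {xs'} {ys} {ys'} p q =
        ∼trans (≡⇒∼ (F-++ xs ys)) (∼trans (∼++ p q) (≡⇒∼ (P.sym (F-++ xs' ys'))))

      resp-comm : ∀ xs ys → F (xs ++ ys) ∼ F (ys ++ xs)
      resp-comm xs ys =
        ∼trans (≡⇒∼ (F-++ xs ys)) (∼trans (∼comm (F xs) (F ys)) (≡⇒∼ (P.sym (F-++ ys xs))))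

    private module ScaleW (s : A) {r : ℕ} = Additive (scaleW R M {r} s) (map-++ _)

    scaleW-resp : ∀ {r} s {ω η : W r} → ω ∼ η → scaleW R M s ω ∼ scaleW R M s η
    scaleW-resp s ∼refl                = ∼refl
    scaleW-resp s (∼sym p)             = ∼sym (scaleW-resp s p)
    scaleW-resp s (∼trans p q)         = ∼trans (scaleW-resp s p) (scaleW-resp s q)
    scaleW-resp s (∼++ p q)            = ScaleW.resp-++ s (scaleW-resp s p) (scaleW-resp s q)
    scaleW-resp s (∼comm ω η)          = ScaleW.resp-comm s ω η
    scaleW-resp s (∼cong a≈b v≈w)      = ∼cong (*-congˡ a≈b) v≈w
    scaleW-resp s (∼zero a≈0)          = ∼zero (trans (*-congˡ a≈0) (zeroʳ s))
    scaleW-resp s (∼add a b v)         = ∼trans (∼add (s * a) (s * b) v) (∼-coefficient (sym (distribˡ s a b)))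
    scaleW-resp s (∼lin+ a v i y z)    = ∼lin+ (s * a) v i y z
    scaleW-resp s (∼lin* a v i t y)    = ∼trans (∼lin* (s * a) v i t y) (∼-coefficient (*-assoc s a t))
    scaleW-resp s (∼alt a v i≢j vi≈vj) = ∼alt (s * a) v i≢j vi≈vj

    infixr 5 _∧_
    _∧_ : ∀ {r} → Carrierᴹ → W r → W (suc r)
    u ∧ ω = map (λ p → (proj₁ p , u ∷ᵥ proj₂ p)) ω

    private module Wedge∧ (u : Carrierᴹ) {r : ℕ} = Additive (λ (ω : W r) → u ∧ ω) (map-++ _)

    ∷ᵥ-set : ∀ {r} u (v : Fin r → Carrierᴹ) i y k →
             (u ∷ᵥ set R M v i y) k ≈ᴹ set R M (u ∷ᵥ v) (suc i) y k
    ∷ᵥ-set u v i y zero    = ≈ᴹ-refl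
    ∷ᵥ-set u v i y (suc k) = ≈ᴹ-refl

    ∷ᵥ-as-set : ∀ {r} u y (v : Fin r → Carrierᴹ) k → (u ∷ᵥ v) k ≈ᴹ set R M (y ∷ᵥ v) zero u k
    ∷ᵥ-as-set u y v zero    = ≈ᴹ-refl
    ∷ᵥ-as-set u y v (suc k) = ≈ᴹ-refl

    ∧-resp : ∀ {r} u {ω η : W r} → ω ∼ η → u ∧ ω ∼ u ∧ η
    ∧-resp u ∼refl                = ∼refl
    ∧-resp u (∼sym p)             = ∼sym (∧-resp u p)
    ∧-resp u (∼trans p q)         = ∼trans (∧-resp u p) (∧-resp u q)
    ∧-resp u (∼++ p q)            = Wedge∧.resp-++ u (∧-resp u p) (∧-resp u q)
    ∧-resp u (∼comm ω η)          = Wedge∧.resp-comm u ω η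
    ∧-resp u (∼cong a≈b v≈w)      = ∼cong a≈b (∷ᵥ-cong ≈ᴹ-refl v≈w)
    ∧-resp u (∼zero a≈0)          = ∼zero a≈0
    ∧-resp u (∼add a b v)         = ∼add a b _
    ∧-resp u (∼lin+ a v i y z)    =
      ∼trans (∼-entries (∷ᵥ-set u v i _))
        (∼trans (∼lin+ a (u ∷ᵥ v) (suc i) y z)
          (∼sym (∼-entries (∷ᵥ-set u v i _) ∷∼ ∼-entries (∷ᵥ-set u v i _))))
    ∧-resp u (∼lin* a v i s y)    =
      ∼trans (∼-entries (∷ᵥ-set u v i _))
        (∼trans (∼lin* a (u ∷ᵥ v) (suc i) s y) (∼sym (∼-entries (∷ᵥ-set u v i _))))
    ∧-resp u (∼alt a v i≢j vi≈vj) = ∼alt a (u ∷ᵥ v) (i≢j ∘ FinP.suc-injective) vi≈vj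

    head-+ : ∀ {r} a y z (v : Fin r → Carrierᴹ) →
             (a , (y +ᴹ z) ∷ᵥ v) ∷ [] ∼ (a , y ∷ᵥ v) ∷ (a , z ∷ᵥ v) ∷ []
    head-+ a y z v =
      ∼trans (∼-entries (∷ᵥ-as-set _ y v))
        (∼trans (∼lin+ a (y ∷ᵥ v) zero y z)
          (∼sym (∼-entries (∷ᵥ-as-set _ y v) ∷∼ ∼-entries (∷ᵥ-as-set _ y v))))

    head-*ₗ : ∀ {r} a s y (v : Fin r → Carrierᴹ) →
              (a , (s *ₗ y) ∷ᵥ v) ∷ [] ∼ (a * s , y ∷ᵥ v) ∷ []
    head-*ₗ a s y v =
      ∼trans (∼-entries (∷ᵥ-as-set _ y v))
        (∼trans (∼lin* a (y ∷ᵥ v) zero s y) (∼sym (∼-entries (∷ᵥ-as-set _ y v))))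

    -- (u + w) ∧ (u + w) = 0 expands to u ∧ w + w ∧ u = 0.
    swap-head : ∀ {r} a u w (z : Fin r → Carrierᴹ) →
                (a , u ∷ᵥ w ∷ᵥ z) ∷ [] ∼ (- a , w ∷ᵥ u ∷ᵥ z) ∷ []
    swap-head a u w z =
      ∼trans (∼sym (≡⇒∼ (++-identityʳ (uw ∷ []))))
        (∼trans (∼++ {ω = uw ∷ []} ∼refl (∼sym (cancel a (w ∷ᵥ u ∷ᵥ z)))) (∼++ uw+wu≈0 ∼refl))
      where
        uw = (a , u ∷ᵥ w ∷ᵥ z)
        wu = (a , w ∷ᵥ u ∷ᵥ z)
        repeated : ∀ x → (a , x ∷ᵥ x ∷ᵥ z) ∷ [] ∼ []
        repeated x = ∼alt a (x ∷ᵥ x ∷ᵥ z) {zero} {suc zero} (λ ()) ≈ᴹ-refl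
        expand : (a , (u +ᴹ w) ∷ᵥ (u +ᴹ w) ∷ᵥ z) ∷ []
                 ∼ (a , u ∷ᵥ u ∷ᵥ z) ∷ uw ∷ wu ∷ (a , w ∷ᵥ w ∷ᵥ z) ∷ []
        expand = ∼trans (head-+ a u w ((u +ᴹ w) ∷ᵥ z))
                   (∼++ {ω = (a , u ∷ᵥ (u +ᴹ w) ∷ᵥ z) ∷ []}
                        (∧-resp u (head-+ a u w z)) (∧-resp w (head-+ a u w z)))
        uw+wu≈0 : uw ∷ wu ∷ [] ∼ []
        uw+wu≈0 = ∼trans (∼sym (drop-null (repeated u)))
                    (∼trans (∼sym (∼++ {ω = _ ∷ uw ∷ wu ∷ []} ∼refl (repeated w)))
                      (∼trans (∼sym expand) (repeated (u +ᴹ w))))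

    ∧-congˡ : ∀ {r} {u w} (ω : W r) → u ≈ᴹ w → u ∧ ω ∼ w ∧ ω
    ∧-congˡ []      u≈w = ∼refl
    ∧-congˡ (x ∷ ω) u≈w = ∼-entries (∷ᵥ-cong u≈w (λ _ → ≈ᴹ-refl)) ∷∼ ∧-congˡ ω u≈w

    ∧-distrib-+ : ∀ {r} y z (ω : W r) → (y +ᴹ z) ∧ ω ∼ (y ∧ ω) ++ (z ∧ ω)
    ∧-distrib-+ y z []            = ∼refl
    ∧-distrib-+ y z ((a , v) ∷ ω) =
      ∼trans (∼++ (head-+ a y z v) (∧-distrib-+ y z ω)) (∼sym (interchange _ _ _ _))

    *ₗ-∧ : ∀ {r} s y (ω : W r) → (s *ₗ y) ∧ ω ∼ y ∧ scaleW R M s ω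
    *ₗ-∧ s y []            = ∼refl
    *ₗ-∧ s y ((a , v) ∷ ω) = ∼trans (head-*ₗ a s y v) (∼-coefficient (*-comm a s)) ∷∼ *ₗ-∧ s y ω

    scaleW-∧ : ∀ {r} s u (ω : W r) → scaleW R M s (u ∧ ω) ≡ u ∧ scaleW R M s ω
    scaleW-∧ s u []      = P.refl
    scaleW-∧ s u (x ∷ ω) = P.cong (_ ∷_) (scaleW-∧ s u ω)

    ∧-swap : ∀ {r} u w (ω : W r) → u ∧ w ∧ ω ∼ scaleW R M (- 1#) (w ∧ u ∧ ω)
    ∧-swap u w []            = ∼refl
    ∧-swap u w ((a , v) ∷ ω) =
      ∼trans (swap-head a u w v) (∼-coefficient (sym (-1*x≈-x a))) ∷∼ ∧-swap u w ω

    ∧-∧-≈ : ∀ {r} {u w} (ω : W r) → u ≈ᴹ w → u ∧ w ∧ ω ∼ []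
    ∧-∧-≈ []            u≈w = ∼refl
    ∧-∧-≈ ((a , v) ∷ ω) u≈w =
      ∼trans (drop-null (∼alt a _ {zero} {suc zero} (λ ()) u≈w)) (∧-∧-≈ ω u≈w)

    sumW : ∀ {n r} → (Fin n → W r) → W r
    sumW {zero}  f = []
    sumW {suc n} f = f zero ++ sumW (f ∘ suc)

    sumW-resp : ∀ {n r} {f g : Fin n → W r} → (∀ j → f j ∼ g j) → sumW f ∼ sumW g
    sumW-resp {zero}  f∼g = ∼refl
    sumW-resp {suc n} f∼g = ∼++ (f∼g zero) (sumW-resp (f∼g ∘ suc))

    sumW-coefficients : ∀ {n r} (e : Fin n → A) (v : Fin r → Carrierᴹ) →
                        sumW (λ j → (e j , v) ∷ []) ∼ (sumR R e , v) ∷ []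
    sumW-coefficients {zero}  e v = ∼sym (∼zero refl)
    sumW-coefficients {suc n} e v = ∼trans (∼refl ∷∼ sumW-coefficients (e ∘ suc) v) (∼add _ _ v)

    head-lincomb : ∀ {n r} a (b : Fin n → A) (x : Fin n → Carrierᴹ) (v : Fin r → Carrierᴹ) →
                   (a , lincomb R M b x ∷ᵥ v) ∷ [] ∼ sumW (λ j → (a * b j , x j ∷ᵥ v) ∷ [])
    head-lincomb {zero}  a b x v =
      ∼trans (∼-entries (∷ᵥ-cong (≈ᴹ-sym (*ₗ-zeroˡ 0ᴹ)) (λ _ → ≈ᴹ-refl)))
        (∼trans (head-*ₗ a 0# 0ᴹ v) (∼zero (zeroʳ a)))
    head-lincomb {suc n} a b x v =
      ∼trans (head-+ a _ _ v)
        (∼++ (head-*ₗ a (b zero) (x zero) v) (head-lincomb a (b ∘ suc) (x ∘ suc) v))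

    add-multiples-of-head : ∀ {t} a u (v v' : Fin t → Carrierᴹ) (k : Fin t → A) →
                            (∀ i → v i ≈ᴹ v' i +ᴹ k i *ₗ u) →
                            (a , u ∷ᵥ v) ∷ [] ∼ (a , u ∷ᵥ v') ∷ []
    add-multiples-of-head {zero}  a u v v' k v≈v' = ∼-entries (∷ᵥ-cong ≈ᴹ-refl (λ ()))
    add-multiples-of-head {suc t} a u v v' k v≈v' =
      ∼trans fix-first
        (∼trans (swap-head a u _ _)
          (∼trans (∧-resp (v' zero) (add-multiples-of-head (- a) u (v ∘ suc) (v' ∘ suc) (k ∘ suc) (v≈v' ∘ suc)))
            (∼trans (swap-head (- a) _ u _) (∼cong (-‿involutive a) (∷ᵥ-cong ≈ᴹ-refl (∷ᵥ-head-tail v'))))))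
      where
        fix-first : (a , u ∷ᵥ v) ∷ [] ∼ (a , u ∷ᵥ v' zero ∷ᵥ (v ∘ suc)) ∷ []
        fix-first =
          ∼trans (∼-entries (λ { zero → ≈ᴹ-refl ; (suc zero) → v≈v' zero ; (suc (suc i)) → ≈ᴹ-refl }))
            (∼trans (∧-resp u (head-+ a _ _ (v ∘ suc)))
              (∼trans (∼++ {ω = (a , u ∷ᵥ v' zero ∷ᵥ (v ∘ suc)) ∷ []} ∼refl
                        (∼trans (∧-resp u (head-*ₗ a (k zero) u (v ∘ suc)))
                                (∼alt _ _ {zero} {suc zero} (λ ()) ≈ᴹ-refl)))
                (≡⇒∼ (++-identityʳ _))))

    move-to-head : ∀ {n} a (x : Fin (suc n) → Carrierᴹ) j →
                   (a , x j ∷ᵥ (x ∘ punchIn j)) ∷ [] ∼ (a * sign j , x) ∷ []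
    move-to-head a x zero = ∼cong (sym (*-identityʳ a)) (∷ᵥ-head-tail x)
    move-to-head {suc n} a x (suc j) =
      ∼trans (∼-entries (∷ᵥ-cong ≈ᴹ-refl (≈ᴹ-sym ∘ ∷ᵥ-head-tail (x ∘ punchIn (suc j)))))
        (∼trans (swap-head a _ _ _)
          (∼trans (∧-resp (x zero) (move-to-head (- a) (x ∘ suc) j))
            (∼cong (trans (sym (-‿distribˡ-* a _)) (-‿distribʳ-* a _)) (∷ᵥ-head-tail x))))

    -- Expand the first row by linearity, clear the j-th column from the other rows
    -- (which is the Laplace expansion), then move x j back into place.
    wedge-rows : ∀ {n} a (B : Fin n → Fin n → A) (x : Fin n → Carrierᴹ) →
                 (a , (λ i → lincomb R M (B i) x)) ∷ [] ∼ (a * det R B , x) ∷ []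
    wedge-rows {zero}  a B x = ∼cong (sym (*-identityʳ a)) (λ ())
    wedge-rows {suc n} a B x =
      ∼trans (∼-entries (≈ᴹ-sym ∘ ∷ᵥ-head-tail (λ i → lincomb R M (B i) x)))
        (∼trans (head-lincomb a (B zero) x (λ i → lincomb R M (B (suc i)) x))
          (∼trans (sumW-resp column)
            (∼trans (sumW-coefficients (λ j → a * B zero j * minor j * sign j) x) (∼-coefficient laplace))))
      where
        minor : Fin (suc n) → A
        minor j = det R (λ i k → B (suc i) (punchIn j k))
        column : ∀ j → (a * B zero j , x j ∷ᵥ (λ i → lincomb R M (B (suc i)) x)) ∷ []
                       ∼ (a * B zero j * minor j * sign j , x) ∷ []
        column j =
          ∼trans (add-multiples-of-head (a * B zero j) (x j) _
                   (λ i → lincomb R M (B (suc i) ∘ punchIn j) (x ∘ punchIn j)) (λ i → B (suc i) j)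
                   (λ i → ≈ᴹ-trans (lincomb-extract (B (suc i)) x j) (+ᴹ-comm _ _)))
            (∼trans (∧-resp (x j) (wedge-rows (a * B zero j) (λ i k → B (suc i) (punchIn j k)) (x ∘ punchIn j)))
              (move-to-head (a * B zero j * minor j) x j))
        laplace : sumR R (λ j → a * B zero j * minor j * sign j) ≈ a * det R B
        laplace = trans (sumR-cong {g = λ j → a * (B zero j * minor j) * sign j}
                                   (λ j → *-congʳ (*-assoc a (B zero j) (minor j))))
                        (sumR-sign a (λ j → B zero j * minor j))

    AllIn : ∀ {ℓq} → Pred Carrierᴹ ℓq → ∀ {r} → W r → Set (c ⊔ m ⊔ ℓq)
    AllIn Q = All (λ p → ∀ i → Q (proj₂ p i))

    ∧-AllIn : ∀ {ℓq} {Q : Pred Carrierᴹ ℓq} {r} {u} {ω : W r} → Q u → AllIn Q ω → AllIn Q (u ∧ ω)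
    ∧-AllIn {Q = Q} {r} {u} u∈Q ω⊆Q = map⁺ (All.map (λ {p} → extend {p}) ω⊆Q)
      where
        extend : ∀ {p : Term r} → (∀ i → Q (proj₂ p i)) → ∀ i → Q ((u ∷ᵥ proj₂ p) i)
        extend p⊆Q zero    = u∈Q
        extend p⊆Q (suc i) = p⊆Q i

    Im : ∀ {ℓq} → Pred Carrierᴹ ℓq → ∀ {r} → W r → Set (c ⊔ ℓ ⊔ m ⊔ ℓm ⊔ ℓq)
    Im Q {r} ω = Σ (W r) λ η → AllIn Q η × ω ∼ η

    module ImageProperties {ℓq} (Q : Pred Carrierᴹ ℓq) where
      Im-resp : ∀ {r} {ω ω' : W r} → ω ∼ ω' → Im Q ω' → Im Q ω
      Im-resp ω∼ω' (η , η⊆Q , ω'∼η) = η , η⊆Q , ∼trans ω∼ω' ω'∼η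

      Im-++ : ∀ {r} {ω ω' : W r} → Im Q ω → Im Q ω' → Im Q (ω ++ ω')
      Im-++ (η , η⊆Q , ω∼η) (η' , η'⊆Q , ω'∼η') = η ++ η' , ++⁺ η⊆Q η'⊆Q , ∼++ ω∼η ω'∼η'

      Im-sumW : ∀ {n r} (f : Fin n → W r) → (∀ j → Im Q (f j)) → Im Q (sumW f)
      Im-sumW {zero}  f f∈Im = [] , [] , ∼refl
      Im-sumW {suc n} f f∈Im = Im-++ (f∈Im zero) (Im-sumW (f ∘ suc) (f∈Im ∘ suc))

      Im-scaleW : ∀ {r} s {ω : W r} → Im Q ω → Im Q (scaleW R M s ω)
      Im-scaleW s (η , η⊆Q , ω∼η) = scaleW R M s η , map⁺ η⊆Q , scaleW-resp s ω∼η

    -- The interior product  ⋀^(t+1) M → ⋀^t M  of a linear form φ: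
    -- ι (u₀ ∧ … ∧ u_t) = Σ_k (-1)^k φ(u_k) u₀ ∧ … û_k … ∧ u_t.
    module Contraction (φ : Carrierᴹ → A) (φ-cong : ∀ {x y} → x ≈ᴹ y → φ x ≈ φ y)
                       (φ-+ : ∀ x y → φ (x +ᴹ y) ≈ φ x + φ y)
                       (φ-*ₗ : ∀ s x → φ (s *ₗ x) ≈ s * φ x) where

      ι₁ : ∀ {t} → A → (Fin (suc t) → Carrierᴹ) → W t
      ι₁ {zero}  a u = (a * φ (u zero) , u ∘ suc) ∷ []
      ι₁ {suc t} a u = (a * φ (u zero) , u ∘ suc) ∷ u zero ∧ ι₁ (- a) (u ∘ suc)

      ι : ∀ {t} → W (suc t) → W t
      ι = concatMap (uncurry ι₁)

      ι₁-cong : ∀ {t a b} {u w : Fin (suc t) → Carrierᴹ} → a ≈ b → (∀ i → u i ≈ᴹ w i) → ι₁ a u ∼ ι₁ b w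
      ι₁-cong {zero}  a≈b u≈w = ∼cong (*-cong a≈b (φ-cong (u≈w zero))) (u≈w ∘ suc)
      ι₁-cong {suc t} {u = u} a≈b u≈w =
        ∼cong (*-cong a≈b (φ-cong (u≈w zero))) (u≈w ∘ suc) ∷∼
          ∼trans (∧-resp (u zero) (ι₁-cong (-‿cong a≈b) (u≈w ∘ suc))) (∧-congˡ _ (u≈w zero))

      ι₁-congˡ : ∀ {t a b} {u : Fin (suc t) → Carrierᴹ} → a ≈ b → ι₁ a u ∼ ι₁ b u
      ι₁-congˡ a≈b = ι₁-cong a≈b (λ _ → ≈ᴹ-refl)

      ι₁-zero : ∀ {t a} (u : Fin (suc t) → Carrierᴹ) → a ≈ 0# → ι₁ a u ∼ []
      ι₁-zero {zero}  u a≈0 = ∼zero (trans (*-congʳ a≈0) (zeroˡ _))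
      ι₁-zero {suc t} u a≈0 =
        ∼trans (drop-null (∼zero (trans (*-congʳ a≈0) (zeroˡ _))))
          (∧-resp (u zero) (ι₁-zero (u ∘ suc) (trans (-‿cong a≈0) -0#≈0#)))

      ι₁-+ : ∀ {t} a b (u : Fin (suc t) → Carrierᴹ) → ι₁ a u ++ ι₁ b u ∼ ι₁ (a + b) u
      ι₁-+ {zero}  a b u = ∼trans (∼add _ _ _) (∼-coefficient (sym (distribʳ _ a b)))
      ι₁-+ {suc t} a b u =
        ∼trans (interchange _ _ _ _)
          (∼++ {ω = (a * φ (u zero) , u ∘ suc) ∷ (b * φ (u zero) , u ∘ suc) ∷ []}
            (∼trans (∼add _ _ _) (∼-coefficient (sym (distribʳ _ a b))))
            (∼trans (≡⇒∼ (P.sym (map-++ _ (ι₁ (- a) (u ∘ suc)) _)))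
              (∧-resp (u zero) (∼trans (ι₁-+ (- a) (- b) (u ∘ suc)) (ι₁-congˡ (-‿+-comm a b))))))

      scaleW-ι₁ : ∀ {t} s a (u : Fin (suc t) → Carrierᴹ) → scaleW R M s (ι₁ a u) ∼ ι₁ (s * a) u
      scaleW-ι₁ {zero}  s a u = ∼-coefficient (sym (*-assoc s a _))
      scaleW-ι₁ {suc t} s a u =
        ∼-coefficient (sym (*-assoc s a _)) ∷∼
          ∼trans (≡⇒∼ (scaleW-∧ s (u zero) (ι₁ (- a) (u ∘ suc))))
            (∧-resp (u zero) (∼trans (scaleW-ι₁ s (- a) (u ∘ suc)) (ι₁-congˡ (sym (-‿distribʳ-* s a)))))

      ι₁-lin+ : ∀ {t} a (v : Fin (suc t) → Carrierᴹ) i y z →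
                ι₁ a (set R M v i (y +ᴹ z)) ∼ ι₁ a (set R M v i y) ++ ι₁ a (set R M v i z)
      ι₁-lin+ {zero}  a v zero y z =
        ∼trans (∼-coefficient (trans (*-congˡ (φ-+ y z)) (distribˡ a _ _))) (∼sym (∼add _ _ _))
      ι₁-lin+ {suc t} a v zero y z =
        ∼trans (∼++ {ω = (a * φ (y +ᴹ z) , v ∘ suc) ∷ []}
                 (∼trans (∼-coefficient (trans (*-congˡ (φ-+ y z)) (distribˡ a _ _))) (∼sym (∼add _ _ _)))
                 (∧-distrib-+ y z (ι₁ (- a) (v ∘ suc))))
          (∼sym (interchange _ _ _ _))
      ι₁-lin+ {suc t} a v (suc i) y z =
        ∼trans (∼++ (∼lin+ (a * φ (v zero)) (v ∘ suc) i y z)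
                 (∼trans (∧-resp (v zero) (ι₁-lin+ (- a) (v ∘ suc) i y z))
                   (≡⇒∼ (map-++ _ (ι₁ (- a) (set R M (v ∘ suc) i y)) (ι₁ (- a) (set R M (v ∘ suc) i z))))))
          (∼sym (interchange _ _ _ _))

      ι₁-lin* : ∀ {t} a (v : Fin (suc t) → Carrierᴹ) i s y →
                ι₁ a (set R M v i (s *ₗ y)) ∼ ι₁ (a * s) (set R M v i y)
      ι₁-lin* {zero}  a v zero s y = ∼-coefficient (trans (*-congˡ (φ-*ₗ s y)) (sym (*-assoc a s _)))
      ι₁-lin* {suc t} a v zero s y =
        ∼-coefficient (trans (*-congˡ (φ-*ₗ s y)) (sym (*-assoc a s _))) ∷∼
          ∼trans (*ₗ-∧ s y (ι₁ (- a) (v ∘ suc)))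
            (∧-resp y (∼trans (scaleW-ι₁ s (- a) (v ∘ suc))
                               (ι₁-congˡ (trans (sym (-‿distribʳ-* s a)) (-‿cong (*-comm s a))))))
      ι₁-lin* {suc t} a v (suc i) s y =
        ∼trans (∼lin* (a * φ (v zero)) (v ∘ suc) i s y) (∼-coefficient (xy∙z≈xz∙y a _ s)) ∷∼
          ∧-resp (v zero) (∼trans (ι₁-lin* (- a) (v ∘ suc) i s y) (ι₁-congˡ (sym (-‿distribˡ-* a s))))

      -- ι (u ∧ w) = 0 when u occurs in w, so u ∧ ι w = φ(u) w.
      ∧-ι₁-occurring : ∀ {t} b (w : Fin (suc t) → Carrierᴹ) u j → w j ≈ᴹ u →
                       u ∧ ι₁ b w ∼ (b * φ u , w) ∷ []
      ∧-ι₁-occurring {zero} b w u zero wj≈u =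
        ∼cong (*-congˡ (φ-cong wj≈u)) (λ { zero → ≈ᴹ-sym wj≈u ; (suc k) → ≈ᴹ-refl })
      ∧-ι₁-occurring {suc t} b w u zero wj≈u =
        ∼cong (*-congˡ (φ-cong wj≈u)) (λ { zero → ≈ᴹ-sym wj≈u ; (suc k) → ≈ᴹ-refl })
          ∷∼ ∧-∧-≈ (ι₁ (- b) (w ∘ suc)) (≈ᴹ-sym wj≈u)
      ∧-ι₁-occurring {suc t} b w u (suc j) wj≈u =
        ∼trans (drop-null (∼alt _ (u ∷ᵥ (w ∘ suc)) {zero} {suc j} (λ ()) (≈ᴹ-sym wj≈u)))
          (∼trans (∧-swap u (w zero) (ι₁ (- b) (w ∘ suc)))
            (∼trans (scaleW-resp (- 1#) (∧-resp (w zero) (∧-ι₁-occurring (- b) (w ∘ suc) u j wj≈u)))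
              (∼cong (trans (-1*x≈-x _) (trans (-‿cong (sym (-‿distribˡ-* b (φ u)))) (-‿involutive _)))
                     (∷ᵥ-head-tail w))))

      cancel′ : ∀ {t} a x (v : Fin t → Carrierᴹ) → (a * x , v) ∷ (- a * x , v) ∷ [] ∼ []
      cancel′ a x v = ∼trans (∼refl ∷∼ ∼-coefficient (sym (-‿distribˡ-* a x))) (cancel (a * x) v)

      ι₁-alt : ∀ {t} a (v : Fin (suc t) → Carrierᴹ) {i j} → i ≢ j → v i ≈ᴹ v j → ι₁ a v ∼ []
      ι₁-alt {zero}  a v {zero}  {zero}  i≢j vi≈vj = ⊥-elim (i≢j P.refl)
      ι₁-alt {suc t} a v {zero}  {zero}  i≢j vi≈vj = ⊥-elim (i≢j P.refl)
      ι₁-alt {suc t} a v {zero}  {suc j} i≢j vi≈vj =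
        ∼trans (∼refl ∷∼ ∧-ι₁-occurring (- a) (v ∘ suc) (v zero) j (≈ᴹ-sym vi≈vj)) (cancel′ a _ _)
      ι₁-alt {suc t} a v {suc i} {zero}  i≢j vi≈vj =
        ∼trans (∼refl ∷∼ ∧-ι₁-occurring (- a) (v ∘ suc) (v zero) i vi≈vj) (cancel′ a _ _)
      ι₁-alt {suc t} a v {suc i} {suc j} i≢j vi≈vj =
        ∼trans (drop-null (∼alt _ (v ∘ suc) (i≢j ∘ P.cong suc) vi≈vj))
          (∧-resp (v zero) (ι₁-alt (- a) (v ∘ suc) (i≢j ∘ P.cong suc) vi≈vj))

      private module Ι {t : ℕ} = Additive (ι {t}) (concatMap-++ _)

      ι-resp : ∀ {t} {ω η : W (suc t)} → ω ∼ η → ι ω ∼ ι η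
      ι-resp ∼refl                   = ∼refl
      ι-resp (∼sym p)                = ∼sym (ι-resp p)
      ι-resp (∼trans p q)            = ∼trans (ι-resp p) (ι-resp q)
      ι-resp (∼++ {ω} {ω'} {η} {η'} p q) = Ι.resp-++ {xs = ω} {ω'} {η} {η'} (ι-resp p) (ι-resp q)
      ι-resp (∼comm ω η)             = Ι.resp-comm ω η
      ι-resp (∼cong a≈b v≈w)         = ∼++ (ι₁-cong a≈b v≈w) ∼refl
      ι-resp (∼zero {v = v} a≈0)     = ∼++ (ι₁-zero v a≈0) ∼refl
      ι-resp (∼add a b v)            =
        ∼trans (≡⇒∼ (P.sym (++-assoc (ι₁ a v) (ι₁ b v) []))) (∼++ (ι₁-+ a b v) ∼refl)
      ι-resp (∼lin+ a v i y z)       =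
        ∼trans (∼++ (ι₁-lin+ a v i y z) ∼refl)
               (≡⇒∼ (++-assoc (ι₁ a (set R M v i y)) (ι₁ a (set R M v i z)) []))
      ι-resp (∼lin* a v i s y)       = ∼++ (ι₁-lin* a v i s y) ∼refl
      ι-resp (∼alt a v i≢j vi≈vj)    = ∼++ (ι₁-alt a v i≢j vi≈vj) ∼refl

      ι-AllIn : ∀ {ℓq} {Q : Pred Carrierᴹ ℓq} {t} {ω : W (suc t)} → AllIn Q ω → AllIn Q (ι ω)
      ι-AllIn {Q = Q} ω⊆Q = concat⁺ (map⁺ (All.map (λ {p} → ι₁-AllIn (proj₁ p) (proj₂ p)) ω⊆Q))
        where
          ι₁-AllIn : ∀ {t} a (u : Fin (suc t) → Carrierᴹ) → (∀ i → Q (u i)) → AllIn Q (ι₁ a u)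
          ι₁-AllIn {zero}  a u u⊆Q = (u⊆Q ∘ suc) ∷ []
          ι₁-AllIn {suc t} a u u⊆Q =
            (u⊆Q ∘ suc) ∷ ∧-AllIn {Q = Q} (u⊆Q zero) (ι₁-AllIn (- a) (u ∘ suc) (u⊆Q ∘ suc))

      ι₁-φ≈0 : ∀ {t} b (w : Fin (suc t) → Carrierᴹ) → (∀ k → φ (w k) ≈ 0#) → ι₁ b w ∼ []
      ι₁-φ≈0 {zero}  b w φw≈0 = ∼zero (trans (*-congˡ (φw≈0 zero)) (zeroʳ b))
      ι₁-φ≈0 {suc t} b w φw≈0 =
        ∼trans (drop-null (∼zero (trans (*-congˡ (φw≈0 zero)) (zeroʳ b))))
          (∧-resp (w zero) (ι₁-φ≈0 (- b) (w ∘ suc) (φw≈0 ∘ suc)))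

      ι₁-pivot : ∀ {t} b (u : Fin (suc t) → Carrierᴹ) → φ (u zero) ≈ 1# → (∀ k → φ (u (suc k)) ≈ 0#) →
                 ι₁ b u ∼ (b , u ∘ suc) ∷ []
      ι₁-pivot {zero}  b u φu₀≈1 φu≈0 = ∼-coefficient (trans (*-congˡ φu₀≈1) (*-identityʳ b))
      ι₁-pivot {suc t} b u φu₀≈1 φu≈0 =
        ∼-coefficient (trans (*-congˡ φu₀≈1) (*-identityʳ b)) ∷∼ ∧-resp (u zero) (ι₁-φ≈0 (- b) (u ∘ suc) φu≈0)

  module Pushforward {m₁ ℓm₁ m₂ ℓm₂ : Level} (M₁ : Module R m₁ ℓm₁) (M₂ : Module R m₂ ℓm₂)
      (f : Module.Carrierᴹ M₁ → Module.Carrierᴹ M₂)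
      (f-cong : ∀ {x y} → Module._≈ᴹ_ M₁ x y → Module._≈ᴹ_ M₂ (f x) (f y))
      (f-+ : ∀ x y → Module._≈ᴹ_ M₂ (f (Module._+ᴹ_ M₁ x y)) (Module._+ᴹ_ M₂ (f x) (f y)))
      (f-*ₗ : ∀ s x → Module._≈ᴹ_ M₂ (f (Module._*ₗ_ M₁ s x)) (Module._*ₗ_ M₂ s (f x))) where
    private
      module M₁ = Module M₁
      module M₂ = Module M₂
      module W₁ = Wedges M₁
      module W₂ = Wedges M₂

    pushW : ∀ {r} → W₁.W r → W₂.W r
    pushW = map (λ p → (proj₁ p , f ∘ proj₂ p))

    private module Push {r : ℕ} = W₂.Additive (pushW {r}) (map-++ _)

    push-set : ∀ {n} (v : Fin n → M₁.Carrierᴹ) i {y y'} → f y M₂.≈ᴹ y' →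
               ∀ k → f (set R M₁ v i y k) M₂.≈ᴹ set R M₂ (f ∘ v) i y' k
    push-set v zero    fy≈y' zero    = fy≈y'
    push-set v zero    fy≈y' (suc k) = M₂.≈ᴹ-refl
    push-set v (suc i) fy≈y' zero    = M₂.≈ᴹ-refl
    push-set v (suc i) fy≈y' (suc k) = push-set (v ∘ suc) i fy≈y' k

    pushW-resp : ∀ {r} {ω η : W₁.W r} → ω W₁.∼ η → pushW ω W₂.∼ pushW η
    pushW-resp ∼refl                   = ∼refl
    pushW-resp (∼sym p)                = ∼sym (pushW-resp p)
    pushW-resp (∼trans p q)            = ∼trans (pushW-resp p) (pushW-resp q)
    pushW-resp (∼++ {ω} {ω'} {η} {η'} p q) =
      Push.resp-++ {xs = ω} {ω'} {η} {η'} (pushW-resp p) (pushW-resp q)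
    pushW-resp (∼comm ω η)             = Push.resp-comm ω η
    pushW-resp (∼cong a≈b v≈w)         = ∼cong a≈b (f-cong ∘ v≈w)
    pushW-resp (∼zero a≈0)             = ∼zero a≈0
    pushW-resp (∼add a b v)            = ∼add a b _
    pushW-resp (∼lin+ a v i y z)       =
      ∼trans (W₂.∼-entries (push-set v i (f-+ y z)))
        (∼trans (∼lin+ a (f ∘ v) i (f y) (f z))
          (∼sym (W₂.∼-entries (push-set v i M₂.≈ᴹ-refl) W₂.∷∼ W₂.∼-entries (push-set v i M₂.≈ᴹ-refl))))
    pushW-resp (∼lin* a v i s y)       =
      ∼trans (W₂.∼-entries (push-set v i (f-*ₗ s y)))
        (∼trans (∼lin* a (f ∘ v) i s (f y)) (∼sym (W₂.∼-entries (push-set v i M₂.≈ᴹ-refl))))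
    pushW-resp (∼alt a v i≢j vi≈vj)    = ∼alt a (f ∘ v) i≢j (f-cong vi≈vj)

    pushW-AllIn : ∀ {ℓ₁ ℓ₂} {Q₁ : Pred M₁.Carrierᴹ ℓ₁} {Q₂ : Pred M₂.Carrierᴹ ℓ₂} →
                  (∀ {x} → Q₁ x → Q₂ (f x)) → ∀ {r} {ω : W₁.W r} → W₁.AllIn Q₁ ω → W₂.AllIn Q₂ (pushW ω)
    pushW-AllIn Q₁⇒Q₂ ω⊆Q₁ = map⁺ (All.map (λ p⊆Q₁ i → Q₁⇒Q₂ (p⊆Q₁ i)) ω⊆Q₁)

  module _ {m ℓm : Level} (M : Module R m ℓm) where
    _⊕R : Module R (m ⊔ c) (ℓm ⊔ ℓ)
    _⊕R = DirectProduct.⟨module⟩ M TensorUnit.⟨module⟩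

    proj₁-lincomb : ∀ {n} (b : Fin n → A) (y : Fin n → Module.Carrierᴹ _⊕R) →
                    proj₁ (lincomb R _⊕R b y) ≡ lincomb R M b (proj₁ ∘ y)
    proj₁-lincomb {zero}  b y = P.refl
    proj₁-lincomb {suc n} b y = P.cong (Module._+ᴹ_ M _) (proj₁-lincomb (b ∘ suc) (y ∘ suc))

  module _ {m ℓm ℓq : Level} (M : Module R m ℓm) (Q : Pred (Module.Carrierᴹ M) ℓq) where
    open Wedges using (Im)

    -- Contract with the R-coordinate, then forget it.
    drop-pivot : ∀ {t} b (u : Fin (suc t) → Module.Carrierᴹ (M ⊕R)) →
                 proj₂ (u zero) ≈ 1# → (∀ k → proj₂ (u (suc k)) ≈ 0#) →
                 Im (M ⊕R) (Q ∘ proj₁) ((b , u) ∷ []) → Im M Q ((b , proj₁ ∘ u ∘ suc) ∷ [])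
    drop-pivot b u u₀≈1 uₖ≈0 (η , η⊆Q , bu∼η) =
      pushW (ι η) , pushW-AllIn {Q₁ = Q ∘ proj₁} {Q₂ = Q} (λ q → q) (ι-AllIn {Q = Q ∘ proj₁} η⊆Q) ,
      pushW-resp (∼trans (∼sym (∼trans (Wedges.≡⇒∼ (M ⊕R) (++-identityʳ _)) (ι₁-pivot b u u₀≈1 uₖ≈0)))
                         (ι-resp bu∼η))
      where
        open Wedges.Contraction (M ⊕R) proj₂ proj₂ (λ _ _ → refl) (λ _ _ → refl)
        open Pushforward (M ⊕R) M proj₁ proj₁ (λ _ _ → Module.≈ᴹ-refl M) (λ _ _ → Module.≈ᴹ-refl M)

  det-wedge-suffix∈Im : ∀ s {m ℓm ℓq} (M : Module R m ℓm) (Q : Pred (Module.Carrierᴹ M) ℓq) {r n}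
    (s+r≡n : s +ℕ r ≡ n) (x : Fin n → Module.Carrierᴹ M) (B : Fin n → Fin n → A) →
    (∀ i → Q (lincomb R M (B i) x)) → Wedges.Im M Q ((det R B , x ∘ cast s+r≡n ∘ (s ↑ʳ_)) ∷ [])
  det-wedge-suffix∈Im zero M Q P.refl x B rows∈Q =
    (1# , (λ i → lincomb R M (B i) x)) ∷ [] , rows∈Q ∷ [] ,
    ∼trans (∼-entries (λ k → ≈ᴹ-reflexive (P.cong x (FinP.cast-is-id P.refl k))))
      (∼trans (∼-coefficient (sym (*-identityˡ _))) (∼sym (wedge-rows 1# B x)))
    where
      open Module M
      open Wedges M
  det-wedge-suffix∈Im (suc s) M Q {r} {n} s+r≡n x B rows∈Q =
    Im-resp (∼-entries suffix≈) (drop-pivot M Q (det R B) (x⁺ ∘ cast s+r'≡n ∘ (s ↑ʳ_))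
                                   (δ-diag pivot) (λ k → δ-off (not-pivot k)) pivoted)
    where
      open Module M
      open Wedges M
      open ImageProperties Q
      s+r'≡n : s +ℕ suc r ≡ n
      s+r'≡n = P.trans (+-suc s r) s+r≡n
      pivot : Fin n
      pivot = cast s+r'≡n (s ↑ʳ zero)
      x⁺ : Fin n → Module.Carrierᴹ (M ⊕R)
      x⁺ k = x k , δ k pivot
      pivoted : Wedges.Im (M ⊕R) (Q ∘ proj₁) ((det R B , x⁺ ∘ cast s+r'≡n ∘ (s ↑ʳ_)) ∷ [])
      pivoted = det-wedge-suffix∈Im s (M ⊕R) (Q ∘ proj₁) s+r'≡n x⁺ B
                  (λ i → P.subst Q (P.sym (proj₁-lincomb M (B i) x⁺)) (rows∈Q i))
      not-pivot : ∀ k → cast s+r'≡n (s ↑ʳ suc k) ≢ pivot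
      not-pivot k eq with FinP.↑ʳ-injective s _ _ (cast-injective s+r'≡n eq)
      ... | ()
      suffix≈ : ∀ k → x (cast s+r≡n (suc s ↑ʳ k)) ≈ᴹ x (cast s+r'≡n (s ↑ʳ suc k))
      suffix≈ k = ≈ᴹ-reflexive (P.cong x (FinP.toℕ-injective (begin
        toℕ (cast s+r≡n (suc s ↑ʳ k))   ≡⟨ FinP.toℕ-cast s+r≡n _ ⟩
        toℕ (suc s ↑ʳ k)                ≡⟨ FinP.toℕ-↑ʳ (suc s) k ⟩
        suc s +ℕ toℕ k                  ≡⟨ +-suc s (toℕ k) ⟨
        s +ℕ toℕ (suc k)                ≡⟨ FinP.toℕ-↑ʳ s (suc k) ⟨
        toℕ (s ↑ʳ suc k)                ≡⟨ FinP.toℕ-cast s+r'≡n _ ⟨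
        toℕ (cast s+r'≡n (s ↑ʳ suc k))  ∎)))
        where open P.≡-Reasoning

  module _ {m ℓm ℓn : Level} (M : Module R m ℓm) (N : Pred (Module.Carrierᴹ M) ℓn)
           (N-sub : IsSubmodule R M N) where
    open Module M
    open Wedges M
    open ImageProperties N
    open LinearCombinations M
    open IsSubmodule N-sub using (resp)

    det-wedge∈Im : ∀ {n r} (g : Fin n → Carrierᴹ) (B : Fin n → Fin n → A) →
                   (∀ i → N (lincomb R M (B i) g)) →
                   (v : Fin r → Carrierᴹ) (a : Fin r → Fin n → A) →
                   (∀ p → N (v p +ᴹ -ᴹ lincomb R M (a p) g)) →
                   Im N ((det R B , v) ∷ [])
    det-wedge∈Im {n} {r} g B Bg∈N v a v-ag∈N =
      Im-resp (∼cong (sym (det-blockMatrix n r B a)) suffix)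
              (det-wedge-suffix∈Im n M N P.refl (g ++ᵥ v) (blockMatrix B a) rows∈N)
      where
        rows∈N : ∀ i → N (lincomb R M (blockMatrix B a i) (g ++ᵥ v))
        rows∈N i with split n r i
        ... | left i' = resp (≈ᴹ-sym (lincomb-blockMatrix-↑ˡ B a g v i')) (Bg∈N i')
        ... | right p = resp (≈ᴹ-sym (lincomb-blockMatrix-↑ʳ B a g v p)) (v-ag∈N p)
        suffix : ∀ k → v k ≈ᴹ (g ++ᵥ v) (cast P.refl (n ↑ʳ k))
        suffix k = ≈ᴹ-reflexive (P.sym (P.trans (P.cong (g ++ᵥ v) (FinP.cast-is-id P.refl (n ↑ʳ k)))
                                               (P.cong [ g , v ]′ (FinP.splitAt-↑ʳ n r k))))

    Annihilates : A → Set (c ⊔ ℓ ⊔ m ⊔ ℓm ⊔ ℓn)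
    Annihilates a = ∀ {r} (v : Fin r → Carrierᴹ) → Im N ((a , v) ∷ [])

    annihilates-resp : ∀ {a b} → a ≈ b → Annihilates a → Annihilates b
    annihilates-resp a≈b a-ann v = Im-resp (∼-coefficient (sym a≈b)) (a-ann v)

    annihilates-*ˡ : ∀ b {a} → Annihilates a → Annihilates (b * a)
    annihilates-*ˡ b a-ann v = Im-scaleW b (a-ann v)

    annihilates-sumR : ∀ {t} (f : Fin t → A) → (∀ u → Annihilates (f u)) → Annihilates (sumR R f)
    annihilates-sumR f f-ann v = Im-resp (∼sym (sumW-coefficients f v)) (Im-sumW _ (λ u → f-ann u v))

    Fitt⇒annihilates : ∀ {a} → InFitt R M N a → Annihilates a
    Fitt⇒annihilates (n , k , g , rel , (g-spans , rel∈N , _) , t , coef , sel , _ , a≈) =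
      annihilates-resp (sym a≈) (annihilates-sumR _ (λ u → annihilates-*ˡ (coef u) (minor-annihilates u)))
      where
        minor-annihilates : ∀ u → Annihilates (det R (λ i j → rel (sel u i) j))
        minor-annihilates u v = det-wedge∈Im g (λ i j → rel (sel u i) j) (λ i → rel∈N (sel u i))
                                  v (λ p → proj₁ (g-spans (v p))) (λ p → proj₂ (g-spans (v p)))

    annihilates-scaleW : ∀ {a} → Annihilates a → ∀ {r} (ω : W r) → Im N (scaleW R M a ω)
    annihilates-scaleW a-ann []            = [] , [] , ∼refl
    annihilates-scaleW a-ann ((b , v) ∷ ω) =
      Im-++ (Im-resp (∼-coefficient (*-comm _ b)) (annihilates-*ˡ b a-ann v)) (annihilates-scaleW a-ann ω)

lemma3p9 : ∀ {c ℓ m ℓm ℓn : Level} (R : CommutativeRing c ℓ) (M : Module R m ℓm)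
             (N : Pred (Module.Carrierᴹ M) ℓn) →
           IsSubmodule R M N → FinitelyGenerated R M N → FinitelyPresented R M →
           (r : ℕ) → 1 ≤ r →
           (a : CommutativeRing.Carrier R) → InFitt R M N a →
           (ω : Wedge R M r) → InImageWedgeN R M N (scaleW R M a ω)
lemma3p9 R M N N-sub _ _ r _ a a∈Fitt ω
  with annihilates-scaleW R M N N-sub (Fitt⇒annihilates R M N N-sub a∈Fitt) ω
... | η , η⊆N , aω∼η = η , lookup η⊆N , aω∼η
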